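{- Let $G=(V,E)$ be a finite graph. The following statements are equivalent: (1) Every assignment $w:V\to\mathbb{N}_0$ is equatable in $G$. (2) $G$ is connected, $|V|$ is odd, and for every nonempty $U\subseteq V$ the graph $G-U$ has fewer than $|U|$ isolated vertices, where $G-U$ denotes the subgraph of $G$ induced by $V\setminus U$.
   Context: For a weight function $w:V\to\mathbb{N}_0$ on the vertices of $G$ and an edge $e=\{u,v\}\in E$, a positive step on $e$ modifies $w$ by increasing each of $w(u)$ and $w(v)$ by $1$. The assignment $w$ is called equatable in $G$ if there is a finite sequence of positive steps (on edges of $G$, repetitions allowed) after which all vertices have the same weight. -}

module Defs where

open import Data.Nat using (ℕ; zero; suc; _+_; _*_; _<_)
open import Data.Fin using (Fin)
open import Data.Fin.Properties using (_≟_)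
open import Data.Fin.Subset using (Subset; _∈_; _∉_; Nonempty; ∣_∣)
open import Data.Fin.Subset.Properties using (_∈?_)
open import Data.Vec using (tabulate)
open import Data.Bool using (Bool; true; false; if_then_else_; not; _∧_)
open import Data.List using (List; []; _∷_; foldl)
open import Data.Product using (Σ; ∃; ∃-syntax; _×_; _,_)
open import Relation.Nullary using (¬_; Dec; does)
open import Relation.Binary.PropositionalEquality using (_≡_)
open import Data.Fin.Properties using (any?)

record Graph (n : ℕ) : Set₁ where
  field
    Adj      : Fin n → Fin n → Set
    adj?     : ∀ u v → Dec (Adj u v)
    sym      : ∀ {u v} → Adj u v → Adj v u
    irrefl   : ∀ {u} → ¬ Adj u u

module _ {n : ℕ} (G : Graph n) where
  open Graph G

  Edge : Set
  Edge = Σ (Fin n) λ u → Σ (Fin n) λ v → Adj u v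

  ind : Fin n → Fin n → ℕ
  ind x u = if does (x ≟ u) then 1 else 0

  step : (Fin n → ℕ) → Edge → (Fin n → ℕ)
  step w (u , v , _) x = w x + ind x u + ind x v

  applySteps : (Fin n → ℕ) → List Edge → (Fin n → ℕ)
  applySteps = foldl step

  AllEqual : (Fin n → ℕ) → Set
  AllEqual w = ∀ x y → w x ≡ w y

  Equatable : (Fin n → ℕ) → Set
  Equatable w = ∃[ es ] AllEqual (applySteps w es)

  data Walk : Fin n → Fin n → Set where
    here  : ∀ {u} → Walk u u
    there : ∀ {u v w} → Adj u v → Walk v w → Walk u w

  Connected : Set
  Connected = ∀ u v → Walk u v

  -- the set of isolated vertices of G - U (subgraph induced by V \ U):
  -- v ∉ U and there is no x ∉ U adjacent to v
  isolatedSet : Subset n → Subset n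
  isolatedSet U = tabulate λ v →
    not (does (v ∈? U)) ∧ not (does (any? λ x → Dec× (¬∈? x U) (adj? v x)))
    where
    open import Relation.Nullary using (_×-dec_; ¬?)
    Dec× : ∀ {A B : Set} → Dec A → Dec B → Dec (A × B)
    Dec× = _×-dec_
    ¬∈? : ∀ x (U : Subset n) → Dec (x ∉ U)
    ¬∈? x U = ¬? (x ∈? U)

Odd : ℕ → Set
Odd m = ∃[ k ] m ≡ suc (2 * k)

-- Write e v for the unit weight at v and degree S for the vertex degrees of a list S of edges;
-- w is equatable iff some S levels it, i.e. makes w + degree S constant.
--
-- Sufficiency. By Hall's theorem the isolated-vertex condition yields, for each v, a permutation
-- σ of V fixing v with x adjacent to σ x for x ≢ v; the steps on the edges {x , σ x} level 2 e v.
-- Levelled weights are closed under sums, and a levelled summand can be cancelled because every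
-- degree S is then levelled. So e a + e b is levelled whenever a walk joins a and b, and summing
-- e u + e y over all y gives (2k+1) e u + 1 = e u + k (2 e u) + 1 when |V| = 2k+1; hence every
-- e u, and so every weight, is levelled.
--
-- Necessity. If w + degree S is the constant t, then for every φ
--   Σ φ w + Σ_{ab ∈ S} (φ a + φ b) = t Σ φ.
-- For w = e z and φ the indicator of a vertex set C closed under adjacency, the edge sum is even,
-- so |C| is odd; applied to V, and to the component of a vertex and its complement, this gives
-- |V| odd and G connected. For w the indicator of U and φ that of the isolated vertices I of
-- G - U, every edge contributes at most as much to φ as to w, whence |I| t ≤ |U| t - |U|.

module Submission where

open import Defs
open import Data.Nat.Properties using (+-*-semiring)
open import Algebra.Properties.Semiring.Sum +-*-semiring
  using (sum; sum-cong-≗; sum-remove; sum-replicate-zero; ∑-distrib-+; *-distribʳ-sum)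
open import Data.Bool using (if_then_else_)
open import Data.Fin using (Fin; zero; suc; punchIn; punchOut)
open import Data.Fin.Properties using (_≟_; any?; punchInᵢ≢i; punchOut-injective; injective⇒≤)
open import Data.Fin.Subset
  using (Subset; inside; outside; _∈_; _∉_; _⊆_; _⊂_; _⊃_; _∩_; _∪_; _─_; ∁; ⁅_⁆; ∣_∣; ⊥; Nonempty; Empty)
open import Data.Fin.Subset.Induction using (⊂-wellFounded; ⊃-wellFounded)
open import Data.Fin.Subset.Properties
  using (_∈?_; _⊂?_; nonempty?; anySubset?; Empty-unique; ∣⊥∣≡0; ∈⊤; ∣⊤∣≡n; ∣p∣≤n; ∣∁p∣≡n∸∣p∣
        ; p⊆q⇒∣p∣≤∣q∣; x∈p∩q⁻; x∈p∩q⁺; x∈p∪q⁻; x∈p∪q⁺; p⊆p∪q; p∩q⊆p; p─q⊆p; x∈p∧x∉q⇒x∈p─q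
        ; p∩q≢∅⇒p─q⊂p; x∈p⇒p-x⊂p; x∈⁅x⁆; x∈⁅y⁆⇒x≡y; ∣⁅x⁆∣≡1; x≢y⇒x∉⁅y⁆; x∉⁅y⁆⇒x≢y
        ; x∉p⇒x∈∁p; x∈∁p⇒x∉p)
open import Data.List using (List; []; _∷_; _++_; [_]; concat)
import Data.List as List
open import Data.Nat using (ℕ; zero; suc; _+_; _*_; _∸_; _≤_; _<_; z≤n; _≤?_)
open import Data.Nat.Properties
  using (+-suc; +-comm; +-assoc; +-identityʳ; *-identityʳ; *-zeroʳ; *-assoc; *-distribˡ-+; m+n∸n≡m
        ; m+[n∸m]≡n; ≤-trans; ≤-reflexive; ≤-pred; ≰⇒>; <⇒≢; m≤m+n; m<n+m; 1+n≰n; +-mono-≤; +-monoˡ-≤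
        ; +-cancelˡ-≤; *-cancelʳ-<; even≢odd; module ≤-Reasoning)
open import Data.Nat.Tactic.RingSolver using (solve-∀)
open import Data.Product using (∃; _×_; _,_; proj₁; proj₂)
open import Data.Sum using (_⊎_; inj₁; inj₂)
open import Data.Vec using ([]; _∷_; tabulate; there)
open import Data.Vec.Properties using (lookup∘tabulate; []=⇒lookup; lookup⇒[]=)
open import Function using (_∘_; id; const)
open import Function.Bundles using (_⇔_; mk⇔)
open import Function.Definitions using (Injective)
open import Induction.WellFounded using (Acc; acc)
open import Level using (Level)
open import Relation.Binary.PropositionalEquality hiding ([_])
open import Relation.Nullary using (¬_; Dec; yes; no; does; ¬?; _×-dec_; contradiction)
open import Relation.Nullary.Decidable using (dec-true; dec-false)
open import Relation.Unary using (Pred; Decidable)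

private variable
  ℓ : Level
  n : ℕ
  p q r : Subset n
  x y : Fin n

sum-zero : ∀ {f : Fin n → ℕ} → (∀ x → f x ≡ 0) → sum f ≡ 0
sum-zero {n} f≡0 = trans (sum-cong-≗ f≡0) (sum-replicate-zero n)

sum-single : ∀ (f : Fin n → ℕ) a → (∀ x → x ≢ a → f x ≡ 0) → sum f ≡ f a
sum-single {suc n} f a f≡0 = begin
  sum f                                  ≡⟨ sum-remove {i = a} f ⟩
  f a + sum (λ j → f (punchIn a j))      ≡⟨ cong (f a +_) (sum-zero (λ j → f≡0 _ (punchInᵢ≢i a j))) ⟩
  f a + 0                                ≡⟨ +-identityʳ (f a) ⟩
  f a                                    ∎
  where open ≡-Reasoning

sum-const : ∀ n c → sum {n} (λ _ → c) ≡ n * c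
sum-const zero    c = refl
sum-const (suc n) c = cong (c +_) (sum-const n c)

injective⇒surjective : ∀ {f : Fin n → Fin n} → Injective _≡_ _≡_ f → ∀ y → ∃ λ x → f x ≡ y
injective⇒surjective {suc n} {f} f-injective y with any? (λ x → f x ≟ y)
... | yes hit = hit
... | no  miss = contradiction (injective⇒≤ punchOut∘f-injective) 1+n≰n
  where
  f≢y : ∀ x → y ≢ f x
  f≢y x y≡fx = miss (x , sym y≡fx)
  punchOut∘f-injective : Injective _≡_ _≡_ (λ x → punchOut (f≢y x))
  punchOut∘f-injective eq = f-injective (punchOut-injective (f≢y _) (f≢y _) eq)

parity : ∀ m → (∃ λ k → m ≡ 2 * k) ⊎ Odd m
parity zero = inj₁ (0 , refl)
parity (suc m) with parity m
... | inj₁ (k , m≡2k)  = inj₂ (k , cong suc m≡2k)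
... | inj₂ (k , m≡1+2k) = inj₁ (suc k , cong suc (trans m≡1+2k (sym (+-suc k (k + 0)))))

odd+odd⇒¬odd : ∀ {a b} → Odd a → Odd b → ¬ Odd (a + b)
odd+odd⇒¬odd (i , refl) (j , refl) (k , i+j≡k) =
  even≢odd (suc (i + j)) k (trans (sum-of-odds i j) i+j≡k)
  where
  sum-of-odds : ∀ i j → 2 * suc (i + j) ≡ suc (2 * i) + suc (2 * j)
  sum-of-odds = solve-∀

∣p∪q∣+∣p∩q∣≡∣p∣+∣q∣ : ∀ (p q : Subset n) → ∣ p ∪ q ∣ + ∣ p ∩ q ∣ ≡ ∣ p ∣ + ∣ q ∣
∣p∪q∣+∣p∩q∣≡∣p∣+∣q∣ []            []            = refl
∣p∪q∣+∣p∩q∣≡∣p∣+∣q∣ (outside ∷ p) (outside ∷ q) = ∣p∪q∣+∣p∩q∣≡∣p∣+∣q∣ p q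
∣p∪q∣+∣p∩q∣≡∣p∣+∣q∣ (outside ∷ p) (inside  ∷ q) =
  trans (cong suc (∣p∪q∣+∣p∩q∣≡∣p∣+∣q∣ p q)) (sym (+-suc ∣ p ∣ ∣ q ∣))
∣p∪q∣+∣p∩q∣≡∣p∣+∣q∣ (inside  ∷ p) (outside ∷ q) = cong suc (∣p∪q∣+∣p∩q∣≡∣p∣+∣q∣ p q)
∣p∪q∣+∣p∩q∣≡∣p∣+∣q∣ (inside  ∷ p) (inside  ∷ q) = cong suc (begin
  ∣ p ∪ q ∣ + suc ∣ p ∩ q ∣  ≡⟨ +-suc ∣ p ∪ q ∣ ∣ p ∩ q ∣ ⟩
  suc (∣ p ∪ q ∣ + ∣ p ∩ q ∣) ≡⟨ cong suc (∣p∪q∣+∣p∩q∣≡∣p∣+∣q∣ p q) ⟩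
  suc (∣ p ∣ + ∣ q ∣)         ≡⟨ +-suc ∣ p ∣ ∣ q ∣ ⟨
  ∣ p ∣ + suc ∣ q ∣           ∎)
  where open ≡-Reasoning

∣p─q∣+∣p∩q∣≡∣p∣ : ∀ (p q : Subset n) → ∣ p ─ q ∣ + ∣ p ∩ q ∣ ≡ ∣ p ∣
∣p─q∣+∣p∩q∣≡∣p∣ []            []            = refl
∣p─q∣+∣p∩q∣≡∣p∣ (outside ∷ p) (outside ∷ q) = ∣p─q∣+∣p∩q∣≡∣p∣ p q
∣p─q∣+∣p∩q∣≡∣p∣ (outside ∷ p) (inside  ∷ q) = ∣p─q∣+∣p∩q∣≡∣p∣ p q
∣p─q∣+∣p∩q∣≡∣p∣ (inside  ∷ p) (outside ∷ q) = cong suc (∣p─q∣+∣p∩q∣≡∣p∣ p q)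
∣p─q∣+∣p∩q∣≡∣p∣ (inside  ∷ p) (inside  ∷ q) =
  trans (+-suc ∣ p ─ q ∣ ∣ p ∩ q ∣) (cong suc (∣p─q∣+∣p∩q∣≡∣p∣ p q))

∣p∪q∣≤∣p∣+∣q∣ : ∀ (p q : Subset n) → ∣ p ∪ q ∣ ≤ ∣ p ∣ + ∣ q ∣
∣p∪q∣≤∣p∣+∣q∣ p q =
  ≤-trans (m≤m+n ∣ p ∪ q ∣ ∣ p ∩ q ∣) (≤-reflexive (∣p∪q∣+∣p∩q∣≡∣p∣+∣q∣ p q))

p⊆q∪r⇒∣p∣≤∣q∣+∣r∣ : p ⊆ q ∪ r → ∣ p ∣ ≤ ∣ q ∣ + ∣ r ∣
p⊆q∪r⇒∣p∣≤∣q∣+∣r∣ {q = q} {r = r} p⊆q∪r =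
  ≤-trans (p⊆q⇒∣p∣≤∣q∣ p⊆q∪r) (∣p∪q∣≤∣p∣+∣q∣ q r)

disjoint⇒∣p∪q∣≡∣p∣+∣q∣ : ∀ {n} {p q : Subset n} →
                         (∀ {x} → x ∈ p → x ∉ q) → ∣ p ∪ q ∣ ≡ ∣ p ∣ + ∣ q ∣
disjoint⇒∣p∪q∣≡∣p∣+∣q∣ {n = n} {p = p} {q = q} disjoint = begin
  ∣ p ∪ q ∣              ≡⟨ +-identityʳ ∣ p ∪ q ∣ ⟨
  ∣ p ∪ q ∣ + 0          ≡⟨ cong (∣ p ∪ q ∣ +_) (∣⊥∣≡0 n) ⟨
  ∣ p ∪ q ∣ + ∣ ⊥ {n} ∣  ≡⟨ cong (λ (s : Subset n) → ∣ p ∪ q ∣ + ∣ s ∣) (Empty-unique p∩q-empty) ⟨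
  ∣ p ∪ q ∣ + ∣ p ∩ q ∣  ≡⟨ ∣p∪q∣+∣p∩q∣≡∣p∣+∣q∣ p q ⟩
  ∣ p ∣ + ∣ q ∣          ∎
  where
  open ≡-Reasoning
  p∩q-empty : Empty (p ∩ q)
  p∩q-empty (x , x∈p∩q) = let (x∈p , x∈q) = x∈p∩q⁻ p q x∈p∩q in disjoint x∈p x∈q

x∈p⇒⁅x⁆⊆p : x ∈ p → ⁅ x ⁆ ⊆ p
x∈p⇒⁅x⁆⊆p {x = x} x∈p y∈⁅x⁆ = subst (_∈ _) (sym (x∈⁅y⁆⇒x≡y x y∈⁅x⁆)) x∈p

Nonempty⇒∣p∣>0 : Nonempty p → 0 < ∣ p ∣
Nonempty⇒∣p∣>0 (x , x∈p) = subst (_≤ _) (∣⁅x⁆∣≡1 x) (p⊆q⇒∣p∣≤∣q∣ (x∈p⇒⁅x⁆⊆p x∈p))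

Empty⇒∣p∣≡0 : ∀ {n} {p : Subset n} → Empty p → ∣ p ∣ ≡ 0
Empty⇒∣p∣≡0 {n} p-empty = trans (cong ∣_∣ (Empty-unique p-empty)) (∣⊥∣≡0 n)

∣p∣>0⇒Nonempty : ∀ {n} {p : Subset n} → 0 < ∣ p ∣ → Nonempty p
∣p∣>0⇒Nonempty {p = p} ∣p∣>0 with nonempty? p
... | yes p≢∅   = p≢∅
... | no  p-empty = contradiction (Empty⇒∣p∣≡0 p-empty) (≢-sym (<⇒≢ ∣p∣>0))

x∈p─q⇒x∉q : ∀ {n} {p q : Subset n} {x} → x ∈ p ─ q → x ∉ q
x∈p─q⇒x∉q {p = _ ∷ p} {outside ∷ q} (there x∈p─q) (there x∈q) = x∈p─q⇒x∉q x∈p─q x∈q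
x∈p─q⇒x∉q {p = _ ∷ p} {inside  ∷ q} (there x∈p─q) (there x∈q) = x∈p─q⇒x∉q x∈p─q x∈q

select : {P : Pred (Fin n) ℓ} → Decidable P → Subset n
select P? = tabulate (does ∘ P?)

module _ {P : Pred (Fin n) ℓ} (P? : Decidable P) where

  ∈-select⁺ : P x → x ∈ select P?
  ∈-select⁺ {x} px = lookup⇒[]= x _ (trans (lookup∘tabulate _ x) (dec-true (P? x) px))

  ∈-select⁻ : x ∈ select P? → P x
  ∈-select⁻ {x} x∈ with P? x | trans (sym (lookup∘tabulate _ x)) ([]=⇒lookup x∈)
  ... | yes px  | _  = px
  ... | no  ¬px | ()

x≢y⇒x∈∁⁅y⁆ : x ≢ y → x ∈ ∁ ⁅ y ⁆
x≢y⇒x∈∁⁅y⁆ x≢y = x∉p⇒x∈∁p (x≢y⇒x∉⁅y⁆ x≢y)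

x∈∁⁅y⁆⇒x≢y : x ∈ ∁ ⁅ y ⁆ → x ≢ y
x∈∁⁅y⁆⇒x≢y x∈∁⁅y⁆ = x∉⁅y⁆⇒x≢y (x∈∁p⇒x∉p x∈∁⁅y⁆)

∣p∣+∣∁p∣≡n : ∀ (p : Subset n) → ∣ p ∣ + ∣ ∁ p ∣ ≡ n
∣p∣+∣∁p∣≡n {n} p = trans (cong (∣ p ∣ +_) (∣∁p∣≡n∸∣p∣ p)) (m+[n∸m]≡n (∣p∣≤n p))

indicator : Subset n → Fin n → ℕ
indicator p x = if does (x ∈? p) then 1 else 0

sum-indicator : ∀ (p : Subset n) → sum (indicator p) ≡ ∣ p ∣
sum-indicator []            = refl
sum-indicator (inside  ∷ p) = cong suc (sum-indicator p)
sum-indicator (outside ∷ p) = sum-indicator p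

module _ {p : Subset n} {x : Fin n} where

  indicator-∈ : x ∈ p → indicator p x ≡ 1
  indicator-∈ x∈p = cong (λ b → if b then 1 else 0) (dec-true (x ∈? p) x∈p)

  indicator-∉ : x ∉ p → indicator p x ≡ 0
  indicator-∉ x∉p = cong (λ b → if b then 1 else 0) (dec-false (x ∈? p) x∉p)

indicator-≤ : ∀ {p q : Subset n} {x y} → (x ∈ p → y ∈ q) → indicator p x ≤ indicator q y
indicator-≤ {p = p} {x = x} x∈p⇒y∈q with x ∈? p
... | no  _   = z≤n
... | yes x∈p = ≤-reflexive (sym (indicator-∈ (x∈p⇒y∈q x∈p)))

indicator-idem : ∀ (p : Subset n) x → indicator p x * indicator p x ≡ indicator p x
indicator-idem p x with x ∈? p
... | yes _ = refl
... | no  _ = refl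

module Hall {m : ℕ} {R : Fin m → Fin m → Set} (R? : ∀ x y → Dec (R x y)) where

  related? : ∀ X y → Dec (∃ λ x → x ∈ X × R x y)
  related? X y = any? λ x → x ∈? X ×-dec R? x y

  N : Subset m → Subset m
  N X = select (related? X)

  ∈N⁺ : ∀ {X x y} → x ∈ X → R x y → y ∈ N X
  ∈N⁺ {X} x∈X r = ∈-select⁺ (related? X) (_ , x∈X , r)

  ∈N⁻ : ∀ {X y} → y ∈ N X → ∃ λ x → x ∈ X × R x y
  ∈N⁻ {X} = ∈-select⁻ (related? X)

  N-mono : ∀ {X Y} → X ⊆ Y → N X ⊆ N Y
  N-mono X⊆Y y∈NX = let (x , x∈X , r) = ∈N⁻ y∈NX in ∈N⁺ (X⊆Y x∈X) r

  HallCondition : Subset m → Subset m → Set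
  HallCondition A B = ∀ X → X ⊆ A → ∣ X ∣ ≤ ∣ B ∩ N X ∣

  record Matching (A B : Subset m) : Set where
    field
      match           : Fin m → Fin m
      match-∈         : ∀ {x} → x ∈ A → match x ∈ B
      match-related   : ∀ {x} → x ∈ A → R x (match x)
      match-injective : ∀ {x y} → x ∈ A → y ∈ A → match x ≡ match y → x ≡ y

  open Matching

  empty-matching : ∀ {A B} → Empty A → Matching A B
  empty-matching A-empty = record
    { match           = id
    ; match-∈         = λ x∈A → contradiction (_ , x∈A) A-empty
    ; match-related   = λ x∈A → contradiction (_ , x∈A) A-empty
    ; match-injective = λ x∈A _ _ → contradiction (_ , x∈A) A-empty
    }

  singleton-matching : ∀ {a b} → R a b → Matching ⁅ a ⁆ ⁅ b ⁆
  singleton-matching {a} {b} r = record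
    { match           = const b
    ; match-∈         = λ _ → x∈⁅x⁆ b
    ; match-related   = λ x∈⁅a⁆ → subst (λ x → R x b) (sym (x∈⁅y⁆⇒x≡y a x∈⁅a⁆)) r
    ; match-injective = λ x∈⁅a⁆ y∈⁅a⁆ _ → trans (x∈⁅y⁆⇒x≡y a x∈⁅a⁆) (sym (x∈⁅y⁆⇒x≡y a y∈⁅a⁆))
    }

  ∪-matching : ∀ {A A₁ B B₁} → B₁ ⊆ B → Matching A₁ B₁ → Matching (A ─ A₁) (B ─ B₁) → Matching A B
  ∪-matching {A} {A₁} {B} {B₁} B₁⊆B M₁ M₂ = record
    { match           = f
    ; match-∈         = f-∈
    ; match-related   = f-related
    ; match-injective = f-injective
    }
    where
    f : Fin m → Fin m
    f x with x ∈? A₁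
    ... | yes _ = match M₁ x
    ... | no  _ = match M₂ x

    f-∈ : ∀ {x} → x ∈ A → f x ∈ B
    f-∈ {x} x∈A with x ∈? A₁
    ... | yes x∈A₁ = B₁⊆B (match-∈ M₁ x∈A₁)
    ... | no  x∉A₁ = p─q⊆p B B₁ (match-∈ M₂ (x∈p∧x∉q⇒x∈p─q x∈A x∉A₁))

    f-related : ∀ {x} → x ∈ A → R x (f x)
    f-related {x} x∈A with x ∈? A₁
    ... | yes x∈A₁ = match-related M₁ x∈A₁
    ... | no  x∉A₁ = match-related M₂ (x∈p∧x∉q⇒x∈p─q x∈A x∉A₁)

    f-injective : ∀ {x y} → x ∈ A → y ∈ A → f x ≡ f y → x ≡ y
    f-injective {x} {y} x∈A y∈A fx≡fy with x ∈? A₁ | y ∈? A₁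
    ... | yes x∈A₁ | yes y∈A₁ = match-injective M₁ x∈A₁ y∈A₁ fx≡fy
    ... | yes x∈A₁ | no  y∉A₁ = contradiction (subst (_∈ B₁) fx≡fy (match-∈ M₁ x∈A₁))
                                    (x∈p─q⇒x∉q (match-∈ M₂ (x∈p∧x∉q⇒x∈p─q y∈A y∉A₁)))
    ... | no  x∉A₁ | yes y∈A₁ = contradiction (subst (_∈ B₁) (sym fx≡fy) (match-∈ M₁ y∈A₁))
                                    (x∈p─q⇒x∉q (match-∈ M₂ (x∈p∧x∉q⇒x∈p─q x∈A x∉A₁)))
    ... | no  x∉A₁ | no  y∉A₁ =
      match-injective M₂ (x∈p∧x∉q⇒x∈p─q x∈A x∉A₁) (x∈p∧x∉q⇒x∈p─q y∈A y∉A₁) fx≡fy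

  neighbour : ∀ {A B a} → HallCondition A B → a ∈ A → ∃ λ b → b ∈ B × R a b
  neighbour {A} {B} {a} hallAB a∈A =
    let (b , b∈B∩N) = ∣p∣>0⇒Nonempty
          (subst (_≤ ∣ B ∩ N ⁅ a ⁆ ∣) (∣⁅x⁆∣≡1 a) (hallAB ⁅ a ⁆ (x∈p⇒⁅x⁆⊆p a∈A)))
        (b∈B , b∈N) = x∈p∩q⁻ B (N ⁅ a ⁆) b∈B∩N
        (x , x∈⁅a⁆ , r) = ∈N⁻ b∈N
    in b , b∈B , subst (λ x → R x b) (x∈⁅y⁆⇒x≡y a x∈⁅a⁆) r

  Critical : Subset m → Subset m → Subset m → Set
  Critical A B X = Nonempty X × X ⊂ A × ∣ B ∩ N X ∣ ≤ ∣ X ∣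

  critical? : ∀ A B X → Dec (Critical A B X)
  critical? A B X = nonempty? X ×-dec X ⊂? A ×-dec ∣ B ∩ N X ∣ ≤? ∣ X ∣

  hall-restrict : ∀ {A B X} → X ⊆ A → HallCondition A B → HallCondition X (B ∩ N X)
  hall-restrict {A} {B} {X} X⊆A hallAB Y Y⊆X =
    ≤-trans (hallAB Y (λ y∈Y → X⊆A (Y⊆X y∈Y))) (p⊆q⇒∣p∣≤∣q∣ NY⊆NX)
    where
    NY⊆NX : B ∩ N Y ⊆ (B ∩ N X) ∩ N Y
    NY⊆NX y∈ = let (y∈B , y∈NY) = x∈p∩q⁻ B (N Y) y∈ in
      x∈p∩q⁺ (x∈p∩q⁺ (y∈B , N-mono Y⊆X y∈NY) , y∈NY)

  hall-contract : ∀ {A B X} → X ⊆ A → ∣ B ∩ N X ∣ ≤ ∣ X ∣ → HallCondition A B →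
                  HallCondition (A ─ X) (B ─ (B ∩ N X))
  hall-contract {A} {B} {X} X⊆A tight hallAB Y Y⊆A─X = +-cancelˡ-≤ ∣ X ∣ _ _ (begin
    ∣ X ∣ + ∣ Y ∣                            ≡⟨ disjoint⇒∣p∪q∣≡∣p∣+∣q∣ X∩Y≡∅ ⟨
    ∣ X ∪ Y ∣                                ≤⟨ hallAB (X ∪ Y) X∪Y⊆A ⟩
    ∣ B ∩ N (X ∪ Y) ∣                        ≤⟨ p⊆q∪r⇒∣p∣≤∣q∣+∣r∣ cover ⟩
    ∣ B ∩ N X ∣ + ∣ (B ─ (B ∩ N X)) ∩ N Y ∣  ≤⟨ +-monoˡ-≤ _ tight ⟩
    ∣ X ∣ + ∣ (B ─ (B ∩ N X)) ∩ N Y ∣        ∎)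
    where
    open ≤-Reasoning
    X∩Y≡∅ : ∀ {x} → x ∈ X → x ∉ Y
    X∩Y≡∅ x∈X x∈Y = x∈p─q⇒x∉q (Y⊆A─X x∈Y) x∈X
    X∪Y⊆A : X ∪ Y ⊆ A
    X∪Y⊆A x∈X∪Y with x∈p∪q⁻ X Y x∈X∪Y
    ... | inj₁ x∈X = X⊆A x∈X
    ... | inj₂ x∈Y = p─q⊆p A X (Y⊆A─X x∈Y)
    cover : B ∩ N (X ∪ Y) ⊆ (B ∩ N X) ∪ ((B ─ (B ∩ N X)) ∩ N Y)
    cover {y} y∈ with x∈p∩q⁻ B (N (X ∪ Y)) y∈ | y ∈? N X
    ... | y∈B , _       | yes y∈NX = x∈p∪q⁺ (inj₁ (x∈p∩q⁺ (y∈B , y∈NX)))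
    ... | y∈B , y∈NX∪Y | no  y∉NX with ∈N⁻ y∈NX∪Y
    ...   | x , x∈X∪Y , r with x∈p∪q⁻ X Y x∈X∪Y
    ...     | inj₁ x∈X = contradiction (∈N⁺ x∈X r) y∉NX
    ...     | inj₂ x∈Y = x∈p∪q⁺ (inj₂ (x∈p∩q⁺ (x∈p∧x∉q⇒x∈p─q y∈B y∉B∩NX , ∈N⁺ x∈Y r)))
      where
      y∉B∩NX : y ∉ B ∩ N X
      y∉B∩NX y∈B∩NX = y∉NX (proj₂ (x∈p∩q⁻ B (N X) y∈B∩NX))

  hall-edge : ∀ {A B a b} → a ∈ A → ¬ ∃ (Critical A B) → HallCondition A B →
              HallCondition (A ─ ⁅ a ⁆) (B ─ ⁅ b ⁆)
  hall-edge {A} {B} {a} {b} a∈A noncritical hallAB Y Y⊆A-a with nonempty? Y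
  ... | no  Y-empty = subst (_≤ ∣ (B ─ ⁅ b ⁆) ∩ N Y ∣) (sym (Empty⇒∣p∣≡0 Y-empty)) z≤n
  ... | yes Y-nonempty = ≤-pred (begin-strict
    ∣ Y ∣                            <⟨ ≰⇒> (λ tight → noncritical (Y , Y-nonempty , Y⊂A , tight)) ⟩
    ∣ B ∩ N Y ∣                      ≤⟨ p⊆q∪r⇒∣p∣≤∣q∣+∣r∣ cover ⟩
    ∣ (B ─ ⁅ b ⁆) ∩ N Y ∣ + ∣ ⁅ b ⁆ ∣ ≡⟨ cong (∣ (B ─ ⁅ b ⁆) ∩ N Y ∣ +_) (∣⁅x⁆∣≡1 b) ⟩
    ∣ (B ─ ⁅ b ⁆) ∩ N Y ∣ + 1         ≡⟨ +-comm _ 1 ⟩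
    suc ∣ (B ─ ⁅ b ⁆) ∩ N Y ∣         ∎)
    where
    open ≤-Reasoning
    Y⊂A : Y ⊂ A
    Y⊂A = (λ y∈Y → p─q⊆p A ⁅ a ⁆ (Y⊆A-a y∈Y))
        , a , a∈A , λ a∈Y → x∈p─q⇒x∉q (Y⊆A-a a∈Y) (x∈⁅x⁆ a)
    cover : B ∩ N Y ⊆ ((B ─ ⁅ b ⁆) ∩ N Y) ∪ ⁅ b ⁆
    cover {y} y∈ with x∈p∩q⁻ B (N Y) y∈ | y ≟ b
    ... | _ , _       | yes refl = x∈p∪q⁺ (inj₂ (x∈⁅x⁆ b))
    ... | y∈B , y∈NY | no  y≢b  =
      x∈p∪q⁺ (inj₁ (x∈p∩q⁺ (x∈p∧x∉q⇒x∈p─q y∈B (y≢b ∘ x∈⁅y⁆⇒x≡y b) , y∈NY)))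

  -- Split A along a critical subset if there is one; otherwise match some a ∈ A first.
  hall-acc : ∀ {A} → Acc _⊂_ A → ∀ B → HallCondition A B → Matching A B
  hall-acc {A} (acc rec) B hallAB with nonempty? A
  ... | no A-empty = empty-matching A-empty
  ... | yes (a , a∈A) with anySubset? (critical? A B)
  ...   | yes (X , (x , x∈X) , X⊂A@(X⊆A , _) , tight) =
    ∪-matching (p∩q⊆p B (N X))
      (hall-acc (rec X⊂A) (B ∩ N X) (hall-restrict {B = B} X⊆A hallAB))
      (hall-acc (rec (p∩q≢∅⇒p─q⊂p A X (x , x∈p∩q⁺ (X⊆A x∈X , x∈X)))) _
        (hall-contract {B = B} X⊆A tight hallAB))
  ...   | no noncritical =
    let (b , b∈B , r) = neighbour hallAB a∈A in
    ∪-matching (x∈p⇒⁅x⁆⊆p b∈B) (singleton-matching r)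
      (hall-acc (rec (x∈p⇒p-x⊂p a∈A)) _ (hall-edge {B = B} {b = b} a∈A noncritical hallAB))

  hall : ∀ A B → HallCondition A B → Matching A B
  hall A = hall-acc (⊂-wellFounded A)

module _ {n : ℕ} (G : Graph (suc n)) where

  open Graph G using (Adj; adj?) renaming (sym to adj-sym)

  V : Set
  V = Fin (suc n)

  unit : V → V → ℕ
  unit v x = ind G x v

  unit-same : ∀ v → unit v v ≡ 1
  unit-same v = cong (λ b → if b then 1 else 0) (dec-true (v ≟ v) refl)

  unit-other : ∀ {v x} → x ≢ v → unit v x ≡ 0
  unit-other {v} {x} x≢v = cong (λ b → if b then 1 else 0) (dec-false (x ≟ v) x≢v)

  sum-unit : ∀ x → sum (λ v → unit v x) ≡ 1
  sum-unit x =
    trans (sum-single (λ v → unit v x) x (λ v v≢x → unit-other (≢-sym v≢x))) (unit-same x)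

  sum-*-unit : ∀ (f : V → ℕ) v → sum (λ x → f x * unit v x) ≡ f v
  sum-*-unit f v = begin
    sum (λ x → f x * unit v x)
      ≡⟨ sum-single _ v (λ x x≢v → trans (cong (f x *_) (unit-other x≢v)) (*-zeroʳ (f x))) ⟩
    f v * unit v v
      ≡⟨ trans (cong (f v *_) (unit-same v)) (*-identityʳ (f v)) ⟩
    f v
      ∎
    where open ≡-Reasoning

  unit-expansion : ∀ (w : V → ℕ) x → sum (λ u → w u * unit u x) ≡ w x
  unit-expansion w x = begin
    sum (λ u → w u * unit u x)
      ≡⟨ sum-single _ x (λ u u≢x → trans (cong (w u *_) (unit-other (≢-sym u≢x))) (*-zeroʳ (w u))) ⟩
    w x * unit x x
      ≡⟨ trans (cong (w x *_) (unit-same x)) (*-identityʳ (w x)) ⟩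
    w x
      ∎
    where open ≡-Reasoning

  degree : List (Edge G) → V → ℕ
  degree []                x = 0
  degree ((a , b , _) ∷ es) x = unit a x + unit b x + degree es x

  degree-++ : ∀ es fs x → degree (es ++ fs) x ≡ degree es x + degree fs x
  degree-++ []                fs x = refl
  degree-++ ((a , b , _) ∷ es) fs x = trans (cong (unit a x + unit b x +_) (degree-++ es fs x))
                                            (sym (+-assoc (unit a x + unit b x) _ _))

  degree-concat : ∀ {m} (L : Fin m → List (Edge G)) y →
                  degree (concat (List.tabulate L)) y ≡ sum (λ i → degree (L i) y)
  degree-concat {zero}  L y = refl
  degree-concat {suc m} L y =
    trans (degree-++ (L zero) _ y) (cong (degree (L zero) y +_) (degree-concat (L ∘ suc) y))

  applySteps-degree : ∀ w es x → applySteps G w es x ≡ w x + degree es x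
  applySteps-degree w []                x = sym (+-identityʳ (w x))
  applySteps-degree w ((a , b , p) ∷ es) x = begin
    applySteps G (step G w (a , b , p)) es x      ≡⟨ applySteps-degree (step G w (a , b , p)) es x ⟩
    w x + unit a x + unit b x + degree es x      ≡⟨ cong (_+ degree es x) (+-assoc (w x) _ _) ⟩
    w x + (unit a x + unit b x) + degree es x    ≡⟨ +-assoc (w x) _ _ ⟩
    w x + (unit a x + unit b x + degree es x)    ∎
    where open ≡-Reasoning

  record Levelling (w : V → ℕ) : Set where
    constructor levelling
    field
      steps  : List (Edge G)
      height : ℕ
      levels : ∀ x → w x + degree steps x ≡ height

  open Levelling

  equatable⇒levelling : ∀ {w} → Equatable G w → Levelling w
  equatable⇒levelling {w} (es , equal) =
    levelling es (applySteps G w es zero) λ x → trans (sym (applySteps-degree w es x)) (equal x zero)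

  levelling⇒equatable : ∀ {w} → Levelling w → Equatable G w
  levelling⇒equatable {w} (levelling es t levels) = es , λ x y → trans (reaches x) (sym (reaches y))
    where
    reaches : ∀ x → applySteps G w es x ≡ t
    reaches x = trans (applySteps-degree w es x) (levels x)

  levelling-cong : ∀ {w w′} → (∀ x → w x ≡ w′ x) → Levelling w → Levelling w′
  levelling-cong w≗w′ (levelling es t levels) =
    levelling es t λ x → trans (cong (_+ degree es x) (sym (w≗w′ x))) (levels x)

  const-levelling : ∀ c → Levelling (const c)
  const-levelling c = levelling [] c λ _ → +-identityʳ c

  +-levelling : ∀ {w w′} → Levelling w → Levelling w′ → Levelling (λ x → w x + w′ x)
  +-levelling {w} {w′} (levelling es t levels) (levelling es′ t′ levels′) =
    levelling (es ++ es′) (t + t′) λ x → begin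
      w x + w′ x + degree (es ++ es′) x             ≡⟨ cong (w x + w′ x +_) (degree-++ es es′ x) ⟩
      w x + w′ x + (degree es x + degree es′ x)     ≡⟨ interchange (w x) (w′ x) (degree es x) (degree es′ x) ⟩
      (w x + degree es x) + (w′ x + degree es′ x)   ≡⟨ cong₂ _+_ (levels x) (levels′ x) ⟩
      t + t′                                        ∎
    where
    open ≡-Reasoning
    interchange : ∀ a b c d → a + b + (c + d) ≡ (a + c) + (b + d)
    interchange = solve-∀

  *-levelling : ∀ {w} c → Levelling w → Levelling (λ x → c * w x)
  *-levelling zero    L = const-levelling 0
  *-levelling (suc c) L = +-levelling L (*-levelling c L)

  sum-levelling : ∀ {m} {w : Fin m → V → ℕ} → (∀ i → Levelling (w i)) →
                  Levelling (λ x → sum (λ i → w i x))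
  sum-levelling {zero}  L = const-levelling 0
  sum-levelling {suc m} L = +-levelling (L zero) (sum-levelling (λ i → L (suc i)))

  step-levelling : ∀ {w} es → Levelling (λ x → w x + degree es x) → Levelling w
  step-levelling {w} es (levelling es′ t levels) = levelling (es ++ es′) t λ x →
    trans (cong (w x +_) (degree-++ es es′ x)) (trans (sym (+-assoc (w x) _ _)) (levels x))

  shift-levelling : ∀ {w} c → Levelling (λ x → w x + c) → Levelling w
  shift-levelling {w} c (levelling es t levels) = levelling es (t ∸ c) λ x → begin
    w x + degree es x            ≡⟨ m+n∸n≡m (w x + degree es x) c ⟨
    w x + degree es x + c ∸ c    ≡⟨ cong (_∸ c) (swap (w x) (degree es x) c) ⟩
    w x + c + degree es x ∸ c    ≡⟨ cong (_∸ c) (levels x) ⟩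
    t ∸ c                        ∎
    where
    open ≡-Reasoning
    swap : ∀ a b c → a + b + c ≡ a + c + b
    swap = solve-∀

  module _ (double-unit : ∀ v → Levelling (λ x → 2 * unit v x)) where

    edge-levelling : ∀ {a b} → Adj a b → Levelling (λ x → unit a x + unit b x)
    edge-levelling {a} {b} ab = step-levelling [ a , b , ab ]
      (levelling-cong (λ x → rearrange (unit a x) (unit b x))
        (+-levelling (double-unit a) (double-unit b)))
      where
      rearrange : ∀ i j → 2 * i + 2 * j ≡ i + j + (i + j + 0)
      rearrange = solve-∀

    degree-levelling : ∀ es → Levelling (degree es)
    degree-levelling []                 = const-levelling 0
    degree-levelling ((_ , _ , ab) ∷ es) = +-levelling (edge-levelling ab) (degree-levelling es)

    -- If u + degree es is constant, adding the levelling of degree es turns w + u into w + constant.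
    cancel-levelling : ∀ {w u} → Levelling u → Levelling (λ x → w x + u x) → Levelling w
    cancel-levelling {w} {u} (levelling es t levels) L = shift-levelling t
      (levelling-cong (λ x → trans (+-assoc (w x) (u x) _) (cong (w x +_) (levels x)))
        (+-levelling L (degree-levelling es)))

    walk-levelling : ∀ {a b} → Walk G a b → Levelling (λ x → unit a x + unit b x)
    walk-levelling {a} here = levelling-cong (λ x → double (unit a x)) (double-unit a)
      where
      double : ∀ i → 2 * i ≡ i + i
      double = solve-∀
    walk-levelling {a} {b} (there {v = c} ac W) = cancel-levelling (double-unit c)
      (levelling-cong (λ x → rearrange (unit a x) (unit c x) (unit b x))
        (+-levelling (edge-levelling ac) (walk-levelling W)))
      where
      rearrange : ∀ i j k → i + j + (j + k) ≡ i + k + 2 * j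
      rearrange = solve-∀

    unit-levelling : Connected G → Odd (suc n) → ∀ u → Levelling (unit u)
    unit-levelling connected (k , odd) u = cancel-levelling (*-levelling k (double-unit u))
      (shift-levelling 1 (levelling-cong total (sum-levelling (λ y → walk-levelling (connected u y)))))
      where
      total : ∀ x → sum (λ y → unit u x + unit y x) ≡ unit u x + k * (2 * unit u x) + 1
      total x = begin
        sum (λ y → unit u x + unit y x)
          ≡⟨ ∑-distrib-+ {suc n} (λ _ → unit u x) (λ y → unit y x) ⟩
        sum {suc n} (λ _ → unit u x) + sum (λ y → unit y x)
          ≡⟨ cong₂ _+_ (sum-const (suc n) (unit u x)) (sum-unit x) ⟩
        suc n * unit u x + 1
          ≡⟨ cong (λ m → m * unit u x + 1) odd ⟩
        suc (2 * k) * unit u x + 1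
          ≡⟨ rearrange k (unit u x) ⟩
        unit u x + k * (2 * unit u x) + 1
          ∎
        where
        open ≡-Reasoning
        rearrange : ∀ k i → suc (2 * k) * i + 1 ≡ i + k * (2 * i) + 1
        rearrange = solve-∀

    all-levelling : Connected G → Odd (suc n) → ∀ w → Levelling w
    all-levelling connected odd w = levelling-cong (unit-expansion w)
      (sum-levelling (λ u → *-levelling (w u) (unit-levelling connected odd u)))

  -- The steps {x , σ x} with x ≢ v meet every vertex except v twice: once as x, once as σ x.
  module _ (v : V) (σ : V → V) (σ-injective : Injective _≡_ _≡_ σ) (σ-fixes-v : σ v ≡ v)
           (σ-adjacent : ∀ {x} → x ≢ v → Adj x (σ x)) where

    σ-step : ∀ x → Dec (x ≡ v) → List (Edge G)
    σ-step x (yes _)   = []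
    σ-step x (no  x≢v) = [ x , σ x , σ-adjacent x≢v ]

    σ-steps : List (Edge G)
    σ-steps = concat (List.tabulate λ x → σ-step x (x ≟ v))

    degree-σ-step : ∀ x (x≟v : Dec (x ≡ v)) y →
                    degree (σ-step x x≟v) y + 2 * unit v y * unit v x ≡ unit x y + unit (σ x) y
    degree-σ-step x (yes refl) y = begin
      2 * unit x y * unit x x      ≡⟨ cong (2 * unit x y *_) (unit-same x) ⟩
      2 * unit x y * 1             ≡⟨ double (unit x y) ⟩
      unit x y + unit x y          ≡⟨ cong (λ z → unit x y + unit z y) σ-fixes-v ⟨
      unit x y + unit (σ x) y      ∎
      where
      open ≡-Reasoning
      double : ∀ i → 2 * i * 1 ≡ i + i
      double = solve-∀
    degree-σ-step x (no x≢v) y = begin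
      unit x y + unit (σ x) y + 0 + 2 * unit v y * unit v x
        ≡⟨ cong (λ z → unit x y + unit (σ x) y + 0 + 2 * unit v y * z) (unit-other x≢v) ⟩
      unit x y + unit (σ x) y + 0 + 2 * unit v y * 0
        ≡⟨ drop-zeros (unit x y + unit (σ x) y) (2 * unit v y) ⟩
      unit x y + unit (σ x) y
        ∎
      where
      open ≡-Reasoning
      drop-zeros : ∀ i c → i + 0 + c * 0 ≡ i
      drop-zeros = solve-∀

    sum-unit∘σ : ∀ y → sum (λ x → unit (σ x) y) ≡ 1
    sum-unit∘σ y with injective⇒surjective σ-injective y
    ... | x₀ , σx₀≡y = begin
      sum (λ x → unit (σ x) y)  ≡⟨ sum-single _ x₀ (λ x x≢x₀ → unit-other (y≢σx x≢x₀)) ⟩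
      unit (σ x₀) y             ≡⟨ cong (λ z → unit z y) σx₀≡y ⟩
      unit y y                  ≡⟨ unit-same y ⟩
      1                         ∎
      where
      open ≡-Reasoning
      y≢σx : ∀ {x} → x ≢ x₀ → y ≢ σ x
      y≢σx x≢x₀ y≡σx = x≢x₀ (σ-injective (trans (sym y≡σx) (sym σx₀≡y)))

    double-unit-levelling : Levelling (λ x → 2 * unit v x)
    double-unit-levelling = levelling σ-steps 2 λ y → begin
      2 * unit v y + degree σ-steps y
        ≡⟨ cong₂ _+_ (sym (sum-*-unit (const (2 * unit v y)) v)) (degree-concat (λ x → σ-step x (x ≟ v)) y) ⟩
      sum (λ x → 2 * unit v y * unit v x) + sum (λ x → degree (σ-step x (x ≟ v)) y)
        ≡⟨ +-comm (sum (λ x → 2 * unit v y * unit v x)) _ ⟩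
      sum (λ x → degree (σ-step x (x ≟ v)) y) + sum (λ x → 2 * unit v y * unit v x)
        ≡⟨ ∑-distrib-+ (λ x → degree (σ-step x (x ≟ v)) y) (λ x → 2 * unit v y * unit v x) ⟨
      sum (λ x → degree (σ-step x (x ≟ v)) y + 2 * unit v y * unit v x)
        ≡⟨ sum-cong-≗ (λ x → degree-σ-step x (x ≟ v) y) ⟩
      sum (λ x → unit x y + unit (σ x) y)
        ≡⟨ ∑-distrib-+ (λ x → unit x y) (λ x → unit (σ x) y) ⟩
      sum (λ x → unit x y) + sum (λ x → unit (σ x) y)
        ≡⟨ cong₂ _+_ (sum-unit y) (sum-unit∘σ y) ⟩
      2 ∎
      where open ≡-Reasoning

  isolated? : ∀ U v → Dec (v ∉ U × ¬ ∃ λ x → x ∉ U × Adj v x)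
  isolated? U v = ¬? (v ∈? U) ×-dec ¬? (any? λ x → ¬? (x ∈? U) ×-dec adj? v x)

  -- isolatedSet G U is definitionally select (isolated? U).
  ∈-isolated⁻ : ∀ {U v} → v ∈ isolatedSet G U → v ∉ U × (∀ {x} → Adj v x → x ∈ U)
  ∈-isolated⁻ {U} {v} v∈I with ∈-select⁻ (isolated? U) v∈I
  ... | v∉U , no-outer-neighbour = v∉U , neighbour∈U
    where
    neighbour∈U : ∀ {x} → Adj v x → x ∈ U
    neighbour∈U {x} vx with x ∈? U
    ... | yes x∈U = x∈U
    ... | no  x∉U = contradiction (x , x∉U , vx) no-outer-neighbour

  ∈-isolated⁺ : ∀ {U v} → v ∉ U → (∀ {x} → Adj v x → x ∈ U) → v ∈ isolatedSet G U
  ∈-isolated⁺ {U} v∉U neighbour∈U =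
    ∈-select⁺ (isolated? U) (v∉U , λ (x , x∉U , vx) → x∉U (neighbour∈U vx))

  module _ (few-isolated : ∀ U → Nonempty U → ∣ isolatedSet G U ∣ < ∣ U ∣) (v : V) where

    open Hall adj?

    -- The vertices of I = X ─ N X are isolated in G - U for U = (∁ ⁅ v ⁆ ∩ N I) ∪ ⁅ v ⁆.
    hall-condition : HallCondition (∁ ⁅ v ⁆) (∁ ⁅ v ⁆)
    hall-condition X X⊆B = begin
      ∣ X ∣                              ≡⟨ ∣p─q∣+∣p∩q∣≡∣p∣ X (N X) ⟨
      ∣ I ∣ + ∣ X ∩ N X ∣                ≤⟨ +-monoˡ-≤ _ ∣I∣≤∣S∣ ⟩
      ∣ S ∣ + ∣ X ∩ N X ∣                ≡⟨ disjoint⇒∣p∪q∣≡∣p∣+∣q∣ S-disjoint ⟨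
      ∣ S ∪ (X ∩ N X) ∣                  ≤⟨ p⊆q⇒∣p∣≤∣q∣ S∪XNX⊆BNX ⟩
      ∣ ∁ ⁅ v ⁆ ∩ N X ∣                  ∎
      where
      open ≤-Reasoning
      B I S U : Subset (suc n)
      B = ∁ ⁅ v ⁆
      I = X ─ N X
      S = B ∩ N I
      U = S ∪ ⁅ v ⁆

      I⊆X : I ⊆ X
      I⊆X = p─q⊆p X (N X)

      i∉NX : ∀ {i} → i ∈ I → i ∉ N X
      i∉NX = x∈p─q⇒x∉q

      I⊆isolated : I ⊆ isolatedSet G U
      I⊆isolated {i} i∈I = ∈-isolated⁺ i∉U neighbour∈U
        where
        i∉U : i ∉ U
        i∉U i∈U with x∈p∪q⁻ S ⁅ v ⁆ i∈U
        ... | inj₁ i∈S    = i∉NX i∈I (N-mono I⊆X (proj₂ (x∈p∩q⁻ B (N I) i∈S)))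
        ... | inj₂ i∈⁅v⁆ = x∈∁⁅y⁆⇒x≢y (X⊆B (I⊆X i∈I)) (x∈⁅y⁆⇒x≡y v i∈⁅v⁆)
        neighbour∈U : ∀ {x} → Adj i x → x ∈ U
        neighbour∈U {x} ix with x ≟ v
        ... | yes refl = x∈p∪q⁺ (inj₂ (x∈⁅x⁆ v))
        ... | no  x≢v  = x∈p∪q⁺ (inj₁ (x∈p∩q⁺ (x≢y⇒x∈∁⁅y⁆ x≢v , ∈N⁺ i∈I ix)))

      ∣U∣≡∣S∣+1 : ∣ U ∣ ≡ ∣ S ∣ + 1
      ∣U∣≡∣S∣+1 = trans (disjoint⇒∣p∪q∣≡∣p∣+∣q∣ λ y∈S y∈⁅v⁆ →
                    x∈∁⁅y⁆⇒x≢y (proj₁ (x∈p∩q⁻ B (N I) y∈S)) (x∈⁅y⁆⇒x≡y v y∈⁅v⁆))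
                  (cong (∣ S ∣ +_) (∣⁅x⁆∣≡1 v))

      ∣I∣≤∣S∣ : ∣ I ∣ ≤ ∣ S ∣
      ∣I∣≤∣S∣ = ≤-pred (begin-strict
        ∣ I ∣                 ≤⟨ p⊆q⇒∣p∣≤∣q∣ I⊆isolated ⟩
        ∣ isolatedSet G U ∣   <⟨ few-isolated U (v , x∈p∪q⁺ (inj₂ (x∈⁅x⁆ v))) ⟩
        ∣ U ∣                 ≡⟨ trans ∣U∣≡∣S∣+1 (+-comm ∣ S ∣ 1) ⟩
        suc ∣ S ∣             ∎)

      S-disjoint : ∀ {y} → y ∈ S → y ∉ X ∩ N X
      S-disjoint y∈S y∈X∩NX with ∈N⁻ (proj₂ (x∈p∩q⁻ B (N I) y∈S))
      ... | i , i∈I , iy = i∉NX i∈I (∈N⁺ (proj₁ (x∈p∩q⁻ X (N X) y∈X∩NX)) (adj-sym iy))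

      S∪XNX⊆BNX : S ∪ (X ∩ N X) ⊆ B ∩ N X
      S∪XNX⊆BNX y∈ with x∈p∪q⁻ S (X ∩ N X) y∈
      ... | inj₁ y∈S = let (y∈B , y∈NI) = x∈p∩q⁻ B (N I) y∈S in x∈p∩q⁺ (y∈B , N-mono I⊆X y∈NI)
      ... | inj₂ y∈XNX = let (y∈X , y∈NX) = x∈p∩q⁻ X (N X) y∈XNX in x∈p∩q⁺ (X⊆B y∈X , y∈NX)

    private
      M : Matching (∁ ⁅ v ⁆) (∁ ⁅ v ⁆)
      M = hall (∁ ⁅ v ⁆) (∁ ⁅ v ⁆) hall-condition

    open Matching M

    fix-v : ∀ x → Dec (x ≡ v) → V
    fix-v x (yes _) = v
    fix-v x (no  _) = match x

    σ : V → V
    σ x = fix-v x (x ≟ v)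

    σ-fixes-v : σ v ≡ v
    σ-fixes-v with v ≟ v
    ... | yes _   = refl
    ... | no  v≢v = contradiction refl v≢v

    σ-adjacent : ∀ {x} → x ≢ v → Adj x (σ x)
    σ-adjacent {x} x≢v with x ≟ v
    ... | yes x≡v = contradiction x≡v x≢v
    ... | no  _   = match-related (x≢y⇒x∈∁⁅y⁆ x≢v)

    σ-injective : Injective _≡_ _≡_ σ
    σ-injective {x} {y} σx≡σy with x ≟ v | y ≟ v
    ... | yes x≡v | yes y≡v = trans x≡v (sym y≡v)
    ... | yes _   | no  y≢v =
      contradiction (sym σx≡σy) (x∈∁⁅y⁆⇒x≢y (match-∈ (x≢y⇒x∈∁⁅y⁆ y≢v)))
    ... | no  x≢v | yes _   =
      contradiction σx≡σy (x∈∁⁅y⁆⇒x≢y (match-∈ (x≢y⇒x∈∁⁅y⁆ x≢v)))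
    ... | no  x≢v | no  y≢v = match-injective (x≢y⇒x∈∁⁅y⁆ x≢v) (x≢y⇒x∈∁⁅y⁆ y≢v) σx≡σy

    double-unit : Levelling (λ x → 2 * unit v x)
    double-unit = double-unit-levelling v σ σ-injective σ-fixes-v σ-adjacent

  sufficiency : Connected G → Odd (suc n) → (∀ U → Nonempty U → ∣ isolatedSet G U ∣ < ∣ U ∣) →
                ∀ w → Equatable G w
  sufficiency connected odd few-isolated w =
    levelling⇒equatable (all-levelling (double-unit few-isolated) connected odd w)

  edge-sum : (V → ℕ) → List (Edge G) → ℕ
  edge-sum φ []                = 0
  edge-sum φ ((a , b , _) ∷ es) = φ a + φ b + edge-sum φ es

  sum-*-degree : ∀ φ es → sum (λ x → φ x * degree es x) ≡ edge-sum φ es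
  sum-*-degree φ []                = sum-zero (λ x → *-zeroʳ (φ x))
  sum-*-degree φ ((a , b , _) ∷ es) = begin
    sum (λ x → φ x * (unit a x + unit b x + degree es x))
      ≡⟨ sum-cong-≗ (λ x → distrib (φ x) (unit a x) (unit b x) (degree es x)) ⟩
    sum (λ x → φ x * unit a x + φ x * unit b x + φ x * degree es x)
      ≡⟨ ∑-distrib-+ (λ x → φ x * unit a x + φ x * unit b x) (λ x → φ x * degree es x) ⟩
    sum (λ x → φ x * unit a x + φ x * unit b x) + sum (λ x → φ x * degree es x)
      ≡⟨ cong (_+ sum (λ x → φ x * degree es x))
              (∑-distrib-+ (λ x → φ x * unit a x) (λ x → φ x * unit b x)) ⟩
    sum (λ x → φ x * unit a x) + sum (λ x → φ x * unit b x) + sum (λ x → φ x * degree es x)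
      ≡⟨ cong₂ _+_ (cong₂ _+_ (sum-*-unit φ a) (sum-*-unit φ b)) (sum-*-degree φ es) ⟩
    φ a + φ b + edge-sum φ es ∎
    where
    open ≡-Reasoning
    distrib : ∀ f i j d → f * (i + j + d) ≡ f * i + f * j + f * d
    distrib = solve-∀

  weighted-sum : ∀ φ {w} (L : Levelling w) →
                 sum (λ x → φ x * w x) + edge-sum φ (steps L) ≡ sum φ * height L
  weighted-sum φ {w} (levelling es t levels) = begin
    sum (λ x → φ x * w x) + edge-sum φ es
      ≡⟨ cong (_ +_) (sum-*-degree φ es) ⟨
    sum (λ x → φ x * w x) + sum (λ x → φ x * degree es x)
      ≡⟨ ∑-distrib-+ (λ x → φ x * w x) (λ x → φ x * degree es x) ⟨
    sum (λ x → φ x * w x + φ x * degree es x)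
      ≡⟨ sum-cong-≗ (λ x → trans (sym (*-distribˡ-+ (φ x) (w x) _)) (cong (φ x *_) (levels x))) ⟩
    sum (λ x → φ x * t)
      ≡⟨ *-distribʳ-sum t φ ⟨
    sum φ * t
      ∎
    where open ≡-Reasoning

  edge-sum-mono : ∀ {φ ψ : V → ℕ} → (∀ {a b} → Adj a b → φ a ≤ ψ b) →
                  ∀ es → edge-sum φ es ≤ edge-sum ψ es
  edge-sum-mono φ≤ψ []                 = z≤n
  edge-sum-mono {φ} {ψ} φ≤ψ ((a , b , ab) ∷ es) = +-mono-≤
    (≤-trans (+-mono-≤ (φ≤ψ ab) (φ≤ψ (adj-sym ab))) (≤-reflexive (+-comm (ψ b) (ψ a))))
    (edge-sum-mono φ≤ψ es)

  edge-sum-even : ∀ {φ} → (∀ {a b} → Adj a b → φ a ≡ φ b) →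
                  ∀ es → ∃ λ k → edge-sum φ es ≡ 2 * k
  edge-sum-even φ-const []                 = 0 , refl
  edge-sum-even {φ} φ-const ((a , b , ab) ∷ es) with edge-sum-even φ-const es
  ... | k , ≡2k = φ a + k , (begin
    φ a + φ b + edge-sum φ es  ≡⟨ cong₂ (λ i j → φ a + i + j) (sym (φ-const ab)) ≡2k ⟩
    φ a + φ a + 2 * k          ≡⟨ double (φ a) k ⟩
    2 * (φ a + k)              ∎)
    where
    open ≡-Reasoning
    double : ∀ i k → i + i + 2 * k ≡ 2 * (i + k)
    double = solve-∀

  Closed : Subset (suc n) → Set
  Closed C = ∀ {x y} → x ∈ C → Adj x y → y ∈ C

  ∁-closed : ∀ {C} → Closed C → Closed (∁ C)
  ∁-closed C-closed x∈∁C xy = x∉p⇒x∈∁p λ y∈C → x∈∁p⇒x∉p x∈∁C (C-closed y∈C (adj-sym xy))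

  Reach : V → Set
  Reach v = ∃ λ C → v ∈ C × Closed C × (∀ {x} → x ∈ C → Walk G x v)

  grow : ∀ {v C} → Acc _⊃_ C → v ∈ C → (∀ {x} → x ∈ C → Walk G x v) → Reach v
  grow {v} {C} (acc rec) v∈C walk with any? (λ x → any? (λ y → x ∈? C ×-dec ¬? (y ∈? C) ×-dec adj? x y))
  ... | no no-exit = C , v∈C , C-closed , walk
    where
    C-closed : Closed C
    C-closed {x} {y} x∈C xy with y ∈? C
    ... | yes y∈C = y∈C
    ... | no  y∉C = contradiction (x , y , x∈C , y∉C , xy) no-exit
  ... | yes (x , y , x∈C , y∉C , xy) = grow (rec C⊂C′) (p⊆p∪q ⁅ y ⁆ v∈C) walk′
    where
    C⊂C′ : C ⊂ C ∪ ⁅ y ⁆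
    C⊂C′ = p⊆p∪q ⁅ y ⁆ , y , x∈p∪q⁺ (inj₂ (x∈⁅x⁆ y)) , y∉C
    walk′ : ∀ {z} → z ∈ C ∪ ⁅ y ⁆ → Walk G z v
    walk′ z∈C′ with x∈p∪q⁻ C ⁅ y ⁆ z∈C′
    ... | inj₁ z∈C    = walk z∈C
    ... | inj₂ z∈⁅y⁆ rewrite x∈⁅y⁆⇒x≡y y z∈⁅y⁆ = there (adj-sym xy) (walk x∈C)

  reach : ∀ v → Reach v
  reach v = grow (⊃-wellFounded ⁅ v ⁆) (x∈⁅x⁆ v) λ x∈⁅v⁆ →
    subst (λ x → Walk G x v) (sym (x∈⁅y⁆⇒x≡y v x∈⁅v⁆)) here

  module _ (equatable : ∀ w → Equatable G w) where

    closed-odd : ∀ {C z} → Closed C → z ∈ C → Odd ∣ C ∣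
    closed-odd {C} {z} C-closed z∈C with parity ∣ C ∣
    ... | inj₂ odd           = odd
    ... | inj₁ (j , ∣C∣≡2j) = contradiction (begin
      2 * (j * t)                               ≡⟨ *-assoc 2 j t ⟨
      2 * j * t                                 ≡⟨ cong (_* t) (trans (sym ∣C∣≡2j) (sym (sum-indicator C))) ⟩
      sum χ * t                                 ≡⟨ weighted-sum χ L ⟨
      sum (λ x → χ x * unit z x) + edge-sum χ (steps L)
                                                ≡⟨ cong₂ _+_ (trans (sum-*-unit χ z) (indicator-∈ z∈C)) ≡2k ⟩
      suc (2 * k)                               ∎) (even≢odd (j * t) k)
      where
      open ≡-Reasoning
      L : Levelling (unit z)
      L = equatable⇒levelling (equatable (unit z))
      t : ℕ
      t = height L
      χ : V → ℕ
      χ = indicator C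
      χ-const : ∀ {a b} → Adj a b → χ a ≡ χ b
      χ-const {a} {b} ab with a ∈? C
      ... | yes a∈C = sym (indicator-∈ (C-closed a∈C ab))
      ... | no  a∉C = sym (indicator-∉ λ b∈C → a∉C (C-closed b∈C (adj-sym ab)))
      even-edge-sum : ∃ λ k → edge-sum χ (steps L) ≡ 2 * k
      even-edge-sum = edge-sum-even χ-const (steps L)
      k : ℕ
      k = proj₁ even-edge-sum
      ≡2k : edge-sum χ (steps L) ≡ 2 * k
      ≡2k = proj₂ even-edge-sum

    odd-order : Odd (suc n)
    odd-order = subst Odd (∣⊤∣≡n (suc n)) (closed-odd {z = zero} (λ _ _ → ∈⊤) ∈⊤)

    connected : Connected G
    connected u v with reach v
    ... | C , v∈C , C-closed , walk with u ∈? C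
    ...   | yes u∈C = walk u∈C
    ...   | no  u∉C = contradiction (subst Odd (sym (∣p∣+∣∁p∣≡n C)) odd-order)
      (odd+odd⇒¬odd (closed-odd C-closed v∈C) (closed-odd (∁-closed C-closed) (x∉p⇒x∈∁p u∉C)))

    ∣isolated∣<∣U∣ : ∀ U → Nonempty U → ∣ isolatedSet G U ∣ < ∣ U ∣
    ∣isolated∣<∣U∣ U U≢∅ = *-cancelʳ-< t ∣ I ∣ ∣ U ∣ (begin-strict
      ∣ I ∣ * t                                 ≡⟨ cong (_* t) (sum-indicator I) ⟨
      sum χI * t                                ≡⟨ weighted-sum χI L ⟨
      sum (λ x → χI x * χU x) + edge-sum χI es  ≡⟨ cong (_+ edge-sum χI es) (sum-zero I∩U≡∅) ⟩
      edge-sum χI es                            ≤⟨ edge-sum-mono isolated≤U es ⟩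
      edge-sum χU es                            <⟨ m<n+m _ (Nonempty⇒∣p∣>0 U≢∅) ⟩
      ∣ U ∣ + edge-sum χU es                    ≡⟨ cong (_+ edge-sum χU es) sum-χU² ⟨
      sum (λ x → χU x * χU x) + edge-sum χU es  ≡⟨ weighted-sum χU L ⟩
      sum χU * t                                ≡⟨ cong (_* t) (sum-indicator U) ⟩
      ∣ U ∣ * t                                 ∎)
      where
      open ≤-Reasoning
      I : Subset (suc n)
      I = isolatedSet G U
      χI χU : V → ℕ
      χI = indicator I
      χU = indicator U
      L : Levelling χU
      L = equatable⇒levelling (equatable χU)
      es : List (Edge G)
      es = steps L
      t : ℕ
      t = height L
      I∩U≡∅ : ∀ x → χI x * χU x ≡ 0
      I∩U≡∅ x with x ∈? I
      ... | yes x∈I = cong (1 *_) (indicator-∉ (proj₁ (∈-isolated⁻ x∈I)))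
      ... | no  _   = refl
      isolated≤U : ∀ {a b} → Adj a b → χI a ≤ χU b
      isolated≤U ab = indicator-≤ λ a∈I → proj₂ (∈-isolated⁻ a∈I) ab
      sum-χU² : sum (λ x → χU x * χU x) ≡ ∣ U ∣
      sum-χU² = trans (sum-cong-≗ (indicator-idem U)) (sum-indicator U)


theorem1 : (n : ℕ) (G : Graph (suc n)) →
    ((w : Fin (suc n) → ℕ) → Equatable G w)
    ⇔ (Connected G × Odd (suc n)
       × ((U : Subset (suc n)) → Nonempty U → ∣ isolatedSet G U ∣ < ∣ U ∣))
theorem1 n G = mk⇔
  (λ equatable → connected G equatable , odd-order G equatable , ∣isolated∣<∣U∣ G equatable)
  (λ (connected , odd , few-isolated) → sufficiency G connected odd few-isolated)
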